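{- For every $d\geq 3$, the line graph $L(D_d)$ of the $d$-dragon is a core, i.e. there is no homomorphism from $L(D_d)$ to a proper subgraph of itself.
   Context: For $d\geq 3$, the $d$-dragon $D_d$ is the graph obtained from the complete graph $K_{d+1}$ by replacing one of its edges by a path on 3 vertices (i.e. subdividing one edge once). The line graph $L(G)$ has vertex set $E_G$, two distinct edges adjacent iff they share an endpoint. A homomorphism $f:G\to H$ is a map $V_G\to V_H$ sending edges to edges. -}

module Defs where

open import Data.Nat using (ℕ; zero; suc; _≡ᵇ_; _+_)
open import Data.Bool using (Bool; true; false; _∧_; _∨_; not; T)
open import Data.Fin using (Fin; toℕ; _<_)
open import Data.Product using (Σ; _×_; _,_; proj₁; proj₂; ∃)
open import Data.Sum using (_⊎_)
open import Relation.Binary.PropositionalEquality using (_≡_; _≢_)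
open import Relation.Nullary using (¬_)

record Graph : Set₁ where
  field
    V     : Set
    Adj   : V → V → Set
    sym   : ∀ {u v} → Adj u v → Adj v u
    irref : ∀ {u} → ¬ Adj u u

open Graph public

record Subgraph (G : Graph) : Set₁ where
  field
    VS    : V G → Set
    ES    : V G → V G → Set
    ES⊆   : ∀ {u v} → ES u v → Adj G u v
    ESsym : ∀ {u v} → ES u v → ES v u
    ESend : ∀ {u v} → ES u v → VS u × VS v

open Subgraph public

Proper : {G : Graph} → Subgraph G → Set
Proper {G} H = (∃ λ v → ¬ VS H v) ⊎ (∃ λ u → ∃ λ v → Adj G u v × ¬ ES H u v)

HomToSub : (G : Graph) → Subgraph G → Set
HomToSub G H =
  Σ (V G → V G) λ f →
    (∀ v → VS H (f v)) × (∀ {u v} → Adj G u v → ES H (f u) (f v))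

IsCore : Graph → Set₁
IsCore G = ¬ (Σ (Subgraph G) λ H → Proper H × HomToSub G H)

EdgeOf : (n : ℕ) → (Fin n → Fin n → Bool) → Set
EdgeOf n a = Σ (Fin n × Fin n) λ p → (proj₁ p < proj₂ p) × T (a (proj₁ p) (proj₂ p))

LineGraph : (n : ℕ) (a : Fin n → Fin n → Bool) → Graph
LineGraph n a = record
  { V     = EdgeOf n a
  ; Adj   = λ e f → (proj₁ e ≢ proj₁ f) × Share (proj₁ e) (proj₁ f)
  ; sym   = λ { (ne , s) → (λ eq → ne (symm eq)) , shareSym s }
  ; irref = λ { (ne , _) → ne Relation.Binary.PropositionalEquality.refl }
  }
  where
  open Relation.Binary.PropositionalEquality using () renaming (sym to symm)
  Share : Fin n × Fin n → Fin n × Fin n → Set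
  Share (x , y) (x' , y') = (x ≡ x') ⊎ (x ≡ y') ⊎ (y ≡ x') ⊎ (y ≡ y')
  shareSym : ∀ {p q} → Share p q → Share q p
  shareSym (Data.Sum.inj₁ e) = Data.Sum.inj₁ (symm e)
  shareSym (Data.Sum.inj₂ (Data.Sum.inj₁ e)) = Data.Sum.inj₂ (Data.Sum.inj₂ (Data.Sum.inj₁ (symm e)))
  shareSym (Data.Sum.inj₂ (Data.Sum.inj₂ (Data.Sum.inj₁ e))) = Data.Sum.inj₂ (Data.Sum.inj₁ (symm e))
  shareSym (Data.Sum.inj₂ (Data.Sum.inj₂ (Data.Sum.inj₂ e))) = Data.Sum.inj₂ (Data.Sum.inj₂ (Data.Sum.inj₂ (symm e)))

-- The d-dragon D_d on vertex set Fin (d + 2): vertices 0..d form K_{d+1}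
-- except that the edge {0,1} is replaced by the path 0 - (d+1) - 1.
isZeroOne : ℕ → Bool
isZeroOne zero = true
isZeroOne (suc zero) = true
isZeroOne _ = false

dragonAdjℕ : ℕ → ℕ → ℕ → Bool
dragonAdjℕ d a b =
  not (a ≡ᵇ b) ∧
  ( if (a ≡ᵇ suc d) then isZeroOne b
    else if (b ≡ᵇ suc d) then isZeroOne a
    else not (isZeroOne a ∧ isZeroOne b) )
  where open Data.Bool using (if_then_else_)

dragonAdj : (d : ℕ) → Fin (suc (suc d)) → Fin (suc (suc d)) → Bool
dragonAdj d u v = dragonAdjℕ d (toℕ u) (toℕ v)

LineDragon : ℕ → Graph
LineDragon d = LineGraph (suc (suc d)) (dragonAdj d)

-- Every endomorphism f of L(D_d) is induced by an automorphism of D_d, so it has a homomorphic section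
-- and cannot land in a proper subgraph. For d ≥ 4 the d edges at a vertex x other than the subdivision
-- vertex form a clique of size at least 4 in L(D_d), whose image must again be a star, centred at some σ x.
-- If σ identified two such vertices it would be constant, so every f e would pass through one vertex w;
-- the edges sent to a fixed edge h at w then form a perfect matching either of all vertices or of all but
-- the subdivision vertex, depending on h, and d + 2 would be both even and odd. Hence σ is injective, fixes
-- the subdivision vertex and the pair {0, 1}, and is an automorphism inducing f. For d = 3 the stars are
-- only triangles, and the claim is checked by exhaustive search over the endomorphisms of L(D_3).
module Submission where

open import Defs hiding (sym)
open import Data.Nat as ℕ using (ℕ; zero; suc; _+_; _*_; _≤_; z≤n; s≤s; _≡ᵇ_)
import Data.Nat.Properties as ℕ
open import Algebra.Properties.CommutativeMonoid.Sum ℕ.+-0-commutativeMonoid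
  using (sum; sum-cong-≗; sum-permute; ∑-distrib-+; sum-remove)
open import Data.Bool using (Bool; true; false; T; _∧_; if_then_else_)
open import Data.Bool.ListAction using (all)
open import Data.Bool.Properties using (T?; T-irrelevant)
open import Data.Empty using (⊥; ⊥-elim)
open import Data.Fin as Fin using (Fin; toℕ; fromℕ; punchIn; punchOut)
open import Data.Fin.Patterns using (0F; 1F; 2F; 3F)
open import Data.Fin.Permutation using (permutation)
import Data.Fin.Properties as Fin
open import Data.List using (List; []; _∷_; mapMaybe; cartesianProduct; allFin)
open import Data.List.Membership.Propositional using (_∈_)
open import Data.List.Membership.Propositional.Properties using (∈-allFin; ∈-cartesianProduct⁺)
open import Data.List.Relation.Unary.All as All using (All)
open import Data.List.Relation.Unary.All.Properties using (all⁺; all⁻)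
open import Data.List.Relation.Unary.Any as Any using (Any; here; there)
import Data.List.Relation.Unary.Any.Properties as Any
open import Data.Maybe using (Maybe; just; nothing)
import Data.Maybe.Relation.Unary.Any as Maybe
open import Data.Product using (Σ; ∃; _×_; _,_; proj₁; proj₂; swap)
import Data.Product.Properties as Product
open import Data.Sum using (_⊎_; inj₁; inj₂)
open import Data.Unit using (tt)
open import Function using (_∘_; const)
open import Function.Definitions using (Injective)
open import Relation.Binary.Definitions using (DecidableEquality; tri<; tri≈; tri>)
open import Relation.Binary.PropositionalEquality
open import Relation.Nullary using (¬_; Dec; yes; no)
open import Relation.Nullary.Decidable
  using (isYes; proof; toWitness; fromWitness; decidable-stable; ¬?; _×-dec_; _⊎-dec_; _→-dec_)
open import Relation.Nullary.Reflects using (Reflects; ofʸ; ofⁿ; _×-reflects_)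
open import Relation.Unary using (Decidable)

-- Counting on finite sets

-- Witnesses produced by proofs are kept opaque throughout: nothing computes with them, and letting
-- with-abstraction unfold them makes type checking blow up.
opaque
  injective⇒surjective : ∀ {m} (g : Fin m → Fin m) → Injective _≡_ _≡_ g → ∀ y → ∃ λ x → g x ≡ y
  injective⇒surjective {zero} g inj ()
  injective⇒surjective {suc m} g inj y with Fin.any? (λ x → g x Fin.≟ y)
  ... | yes hit = hit
  ... | no miss with Fin.pigeonhole (ℕ.n<1+n m) (λ x → punchOut {i = y} {j = g x} λ gx≡y → miss (x , sym gx≡y))
  ...   | x , x' , x<x' , eq = ⊥-elim (Fin.<⇒≢ x<x' (inj (Fin.punchOut-injective {i = y} _ _ eq)))

indicator : ∀ {A : Set} → Dec A → ℕ
indicator a = if isYes a then 1 else 0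

count : ∀ {m} {P : Fin m → Set} → Decidable P → ℕ
count P? = sum (indicator ∘ P?)

count-none : ∀ {m} {P : Fin m → Set} (P? : Decidable P) → (∀ x → ¬ P x) → count P? ≡ 0
count-none {zero} P? ¬P = refl
count-none {suc m} P? ¬P with P? Fin.zero
... | yes P0 = ⊥-elim (¬P _ P0)
... | no _ = count-none (λ x → P? (Fin.suc x)) (λ x → ¬P (Fin.suc x))

count-unique : ∀ {m} {P : Fin m → Set} (P? : Decidable P) {c} → P c → (∀ x → P x → x ≡ c) → count P? ≡ 1
count-unique {suc m} P? {c} Pc unique = begin
  count P?                                            ≡⟨ sum-remove {i = c} (indicator ∘ P?) ⟩
  indicator (P? c) + count (λ x → P? (punchIn c x))   ≡⟨ cong₂ _+_ (indicator-c (P? c)) rest-empty ⟩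
  1 ∎
  where
  open ≡-Reasoning
  indicator-c : ∀ c? → indicator c? ≡ 1
  indicator-c (yes _) = refl
  indicator-c (no ¬Pc) = ⊥-elim (¬Pc Pc)
  rest-empty : count (λ x → P? (punchIn c x)) ≡ 0
  rest-empty = count-none _ λ x P → Fin.punchInᵢ≢i c x (unique _ P)

sum-ones : ∀ m → sum {m} (λ _ → 1) ≡ m
sum-ones zero = refl
sum-ones (suc m) = cong suc (sum-ones m)

module _ {m} (p : Fin m → Fin m) (involutive : ∀ x → p (p x) ≡ x) where

  private
    fixed below above : Fin m → ℕ
    fixed x = indicator (p x Fin.≟ x)
    below x = indicator (x Fin.<? p x)
    above x = indicator (p x Fin.<? x)

    trichotomy : ∀ x → fixed x + (below x + above x) ≡ 1
    trichotomy x with p x Fin.≟ x | x Fin.<? p x | p x Fin.<? x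
    ... | yes px≡x | yes x<px | _        = ⊥-elim (Fin.<-irrefl (sym px≡x) x<px)
    ... | yes px≡x | no _     | yes px<x = ⊥-elim (Fin.<-irrefl px≡x px<x)
    ... | yes _    | no _     | no _     = refl
    ... | no _     | yes x<px | yes px<x = ⊥-elim (Fin.<-asym x<px px<x)
    ... | no _     | yes _    | no _     = refl
    ... | no _     | no _     | yes _    = refl
    ... | no px≢x  | no x≮px  | no px≮x with Fin.<-cmp x (p x)
    ...   | tri< x<px _ _ = ⊥-elim (x≮px x<px)
    ...   | tri≈ _ x≡px _ = ⊥-elim (px≢x (sym x≡px))
    ...   | tri> _ _ px<x = ⊥-elim (px≮x px<x)

    -- Reindexing the sum along the involution p swaps x < p x and p x < x.
    below≡above : sum below ≡ sum above
    below≡above = trans (sum-permute below (permutation p p involutive involutive))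
                        (sum-cong-≗ λ x → cong (λ y → indicator (p x Fin.<? y)) (involutive x))

  fixed-points+2*pairs≡size : count (λ x → p x Fin.≟ x) + 2 * count (λ x → x Fin.<? p x) ≡ m
  fixed-points+2*pairs≡size = begin
    sum fixed + 2 * sum below                     ≡⟨ cong (λ k → sum fixed + (sum below + k)) (trans (ℕ.+-identityʳ _) below≡above) ⟩
    sum fixed + (sum below + sum above)           ≡⟨ cong (sum fixed +_) (∑-distrib-+ below above) ⟨
    sum fixed + sum (λ x → below x + above x)     ≡⟨ ∑-distrib-+ fixed _ ⟨
    sum (λ x → fixed x + (below x + above x))     ≡⟨ sum-cong-≗ trichotomy ⟩
    sum {m} (λ _ → 1)                             ≡⟨ sum-ones m ⟩
    m ∎
    where open ≡-Reasoning

  private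
    pairs : ℕ
    pairs = count (λ x → x Fin.<? p x)

  fixed-point-free⇒even : (∀ x → p x ≢ x) → ∃ λ k → 2 * k ≡ m
  fixed-point-free⇒even free = pairs , trans (cong (_+ 2 * pairs) (sym (count-none _ free))) fixed-points+2*pairs≡size

  unique-fixed-point⇒odd : ∀ {c} → p c ≡ c → (∀ x → p x ≡ x → x ≡ c) → ∃ λ k → suc (2 * k) ≡ m
  unique-fixed-point⇒odd fixed-c unique =
    pairs , trans (cong (_+ 2 * pairs) (sym (count-unique _ fixed-c unique))) fixed-points+2*pairs≡size

three-into-two : ∀ {A : Set} {a b x y z : A} → x ≢ y → x ≢ z → y ≢ z →
                 x ≡ a ⊎ x ≡ b → y ≡ a ⊎ y ≡ b → z ≡ a ⊎ z ≡ b → ⊥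
three-into-two x≢y x≢z y≢z (inj₁ p) (inj₁ q) _ = x≢y (trans p (sym q))
three-into-two x≢y x≢z y≢z (inj₂ p) (inj₂ q) _ = x≢y (trans p (sym q))
three-into-two x≢y x≢z y≢z (inj₁ p) _ (inj₁ r) = x≢z (trans p (sym r))
three-into-two x≢y x≢z y≢z (inj₂ p) _ (inj₂ r) = x≢z (trans p (sym r))
three-into-two x≢y x≢z y≢z _ (inj₁ q) (inj₁ r) = y≢z (trans q (sym r))
three-into-two x≢y x≢z y≢z _ (inj₂ q) (inj₂ r) = y≢z (trans q (sym r))

-- Graphs and line graphs

IsHomomorphism : (G : Graph) → (V G → V G) → Set
IsHomomorphism G f = ∀ {u v} → Adj G u v → Adj G (f u) (f v)

adjacent⇒≢ : ∀ (G : Graph) {u v} → Adj G u v → u ≢ v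
adjacent⇒≢ G uv refl = irref G uv

HomomorphicSection : (G : Graph) → (V G → V G) → Set
HomomorphicSection G f = Σ (V G → V G) λ g → (∀ x → f (g x) ≡ x) × IsHomomorphism G g

sections⇒isCore : ∀ G → (∀ f → IsHomomorphism G f → HomomorphicSection G f) → IsCore G
sections⇒isCore G split (H , proper , f , f-VS , f-ES) with split f (ES⊆ H ∘ f-ES)
... | g , f∘g , g-hom with proper
...   | inj₁ (v , v∉H) = v∉H (subst (VS H) (f∘g v) (f-VS (g v)))
...   | inj₂ (u , v , uv , uv∉H) = uv∉H (subst₂ (ES H) (f∘g u) (f∘g v) (f-ES (g-hom uv)))

module LineGraphProperties {n} (a : Fin n → Fin n → Bool)
  (a-sym : ∀ {x y} → T (a x y) → T (a y x)) (a-irrefl : ∀ {x} → ¬ T (a x x)) where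

  L : Graph
  L = LineGraph n a

  Edge : Set
  Edge = EdgeOf n a

  _∈ₑ_ : Fin n → Edge → Set
  z ∈ₑ ((u , v) , _) = z ≡ u ⊎ z ≡ v

  infix 4 _∈ₑ_

  edge-≡ : ∀ {e e' : Edge} → proj₁ e ≡ proj₁ e' → e ≡ e'
  edge-≡ {_ , u<v , auv} {_ , u<v' , auv'} refl = cong₂ (λ p q → _ , p , q) (ℕ.<-irrelevant u<v u<v') (T-irrelevant auv auv')

  endpoints-distinct : ∀ (e : Edge) → proj₁ (proj₁ e) ≢ proj₂ (proj₁ e)
  endpoints-distinct (_ , u<v , _) = Fin.<⇒≢ u<v

  endpoint-cases : ∀ {z z' y} (e : Edge) → z ≢ z' → z ∈ₑ e → z' ∈ₑ e → y ∈ₑ e → y ≡ z ⊎ y ≡ z'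
  endpoint-cases e z≢z' (inj₁ refl) (inj₁ refl) _ = ⊥-elim (z≢z' refl)
  endpoint-cases e z≢z' (inj₂ refl) (inj₂ refl) _ = ⊥-elim (z≢z' refl)
  endpoint-cases e z≢z' (inj₁ refl) (inj₂ refl) y∈e = y∈e
  endpoint-cases e z≢z' (inj₂ refl) (inj₁ refl) (inj₁ y≡u) = inj₂ y≡u
  endpoint-cases e z≢z' (inj₂ refl) (inj₁ refl) (inj₂ y≡v) = inj₁ y≡v

  edge-unique : ∀ {z z'} (e e' : Edge) → z ≢ z' → z ∈ₑ e → z' ∈ₑ e → z ∈ₑ e' → z' ∈ₑ e' → e ≡ e'
  edge-unique e e' z≢z' (inj₁ refl) (inj₁ refl) _ _ = ⊥-elim (z≢z' refl)
  edge-unique e e' z≢z' (inj₂ refl) (inj₂ refl) _ _ = ⊥-elim (z≢z' refl)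
  edge-unique e e' z≢z' _ _ (inj₁ refl) (inj₁ z'≡u') = ⊥-elim (z≢z' (sym z'≡u'))
  edge-unique e e' z≢z' _ _ (inj₂ refl) (inj₂ z'≡v') = ⊥-elim (z≢z' (sym z'≡v'))
  edge-unique e e' z≢z' (inj₁ refl) (inj₂ refl) (inj₁ u≡u') (inj₂ v≡v') = edge-≡ (cong₂ _,_ u≡u' v≡v')
  edge-unique e e' z≢z' (inj₂ refl) (inj₁ refl) (inj₂ v≡v') (inj₁ u≡u') = edge-≡ (cong₂ _,_ u≡u' v≡v')
  edge-unique (_ , u<v , _) (_ , u'<v' , _) z≢z' (inj₁ refl) (inj₂ refl) (inj₂ refl) (inj₁ refl) = ⊥-elim (Fin.<-asym u<v u'<v')
  edge-unique (_ , u<v , _) (_ , u'<v' , _) z≢z' (inj₂ refl) (inj₁ refl) (inj₁ refl) (inj₂ refl) = ⊥-elim (Fin.<-asym u<v u'<v')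

  other-endpoint : ∀ {z} (e : Edge) → z ∈ₑ e → Σ (Fin n) λ z' → z' ∈ₑ e × z' ≢ z
  other-endpoint e (inj₁ refl) = _ , inj₂ refl , endpoints-distinct e ∘ sym
  other-endpoint e (inj₂ refl) = _ , inj₁ refl , endpoints-distinct e

  endpoints-adjacent : ∀ {z z'} (e : Edge) → z ≢ z' → z ∈ₑ e → z' ∈ₑ e → T (a z z')
  endpoints-adjacent e z≢z' (inj₁ refl) (inj₁ refl) = ⊥-elim (z≢z' refl)
  endpoints-adjacent e z≢z' (inj₂ refl) (inj₂ refl) = ⊥-elim (z≢z' refl)
  endpoints-adjacent e z≢z' (inj₁ refl) (inj₂ refl) = proj₂ (proj₂ e)
  endpoints-adjacent e z≢z' (inj₂ refl) (inj₁ refl) = a-sym (proj₂ (proj₂ e))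

  opaque
    edge-between : ∀ u v → T (a u v) → Σ Edge λ e → u ∈ₑ e × v ∈ₑ e
    edge-between u v auv with Fin.<-cmp u v
    ... | tri< u<v _ _ = ((u , v) , u<v , auv) , inj₁ refl , inj₂ refl
    ... | tri≈ _ refl _ = ⊥-elim (a-irrefl auv)
    ... | tri> _ _ v<u = ((v , u) , v<u , a-sym auv) , inj₂ refl , inj₁ refl

  adjacent⇒common-endpoint : ∀ e e' → Adj L e e' → Σ (Fin n) λ z → z ∈ₑ e × z ∈ₑ e'
  adjacent⇒common-endpoint _ _ (_ , inj₁ u≡u') = _ , inj₁ refl , inj₁ u≡u'
  adjacent⇒common-endpoint _ _ (_ , inj₂ (inj₁ u≡v')) = _ , inj₁ refl , inj₂ u≡v'
  adjacent⇒common-endpoint _ _ (_ , inj₂ (inj₂ (inj₁ v≡u'))) = _ , inj₂ refl , inj₁ v≡u'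
  adjacent⇒common-endpoint _ _ (_ , inj₂ (inj₂ (inj₂ v≡v'))) = _ , inj₂ refl , inj₂ v≡v'

  common-endpoint⇒adjacent : ∀ {e e' z} → e ≢ e' → z ∈ₑ e → z ∈ₑ e' → Adj L e e'
  common-endpoint⇒adjacent {e} {e'} e≢e' z∈e z∈e' = e≢e' ∘ edge-≡ , shared z∈e z∈e'
    where
    shared : ∀ {z} → z ∈ₑ e → z ∈ₑ e' →
             let (u , v) = proj₁ e ; (u' , v') = proj₁ e' in u ≡ u' ⊎ u ≡ v' ⊎ v ≡ u' ⊎ v ≡ v'
    shared (inj₁ refl) (inj₁ refl) = inj₁ refl
    shared (inj₁ refl) (inj₂ refl) = inj₂ (inj₁ refl)
    shared (inj₂ refl) (inj₁ refl) = inj₂ (inj₂ (inj₁ refl))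
    shared (inj₂ refl) (inj₂ refl) = inj₂ (inj₂ (inj₂ refl))

  _∈ₑ?_ : ∀ z e → Dec (z ∈ₑ e)
  z ∈ₑ? e = (z Fin.≟ proj₁ (proj₁ e)) ⊎-dec (z Fin.≟ proj₂ (proj₁ e))

  _≟ₑ_ : ∀ (e e' : Edge) → Dec (e ≡ e')
  e ≟ₑ e' with Product.≡-dec Fin._≟_ Fin._≟_ (proj₁ e) (proj₁ e')
  ... | yes same = yes (edge-≡ same)
  ... | no differ = no (differ ∘ cong proj₁)

  adjacent? : ∀ e e' → Dec (Adj L e e')
  adjacent? ((u , v) , _) ((u' , v') , _) =
    ¬? (Product.≡-dec Fin._≟_ Fin._≟_ (u , v) (u' , v')) ×-dec
      (u Fin.≟ u' ⊎-dec u Fin.≟ v' ⊎-dec v Fin.≟ u' ⊎-dec v Fin.≟ v')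

  shared-endpoint-avoiding : ∀ {z z'} e c → Adj L e c → z ≢ z' → z ∈ₑ e → z' ∈ₑ e → ¬ z ∈ₑ c → z' ∈ₑ c
  shared-endpoint-avoiding e c ec z≢z' z∈e z'∈e z∉c with adjacent⇒common-endpoint e c ec
  ... | y , y∈e , y∈c with endpoint-cases e z≢z' z∈e z'∈e y∈e
  ...   | inj₁ refl = ⊥-elim (z∉c y∈c)
  ...   | inj₂ refl = y∈c

  -- A 4-clique of a line graph is a star: a triangle of the base graph has no fourth edge meeting all three sides.
  clique₄-common-endpoint : ∀ {w} (e₁ e₂ e₃ e₄ : Edge) → Adj L e₁ e₂ → Adj L e₁ e₃ → Adj L e₂ e₃ →
    Adj L e₁ e₄ → Adj L e₂ e₄ → Adj L e₃ e₄ → w ∈ₑ e₁ → w ∈ₑ e₂ → w ∈ₑ e₃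
  clique₄-common-endpoint {w} e₁ e₂ e₃ e₄ e₁e₂ e₁e₃ e₂e₃ e₁e₄ e₂e₄ e₃e₄ w∈e₁ w∈e₂ with w ∈ₑ? e₃
  ... | yes w∈e₃ = w∈e₃
  ... | no w∉e₃ with other-endpoint e₁ w∈e₁ | other-endpoint e₂ w∈e₂
  ...   | x₁ , x₁∈e₁ , x₁≢w | x₂ , x₂∈e₂ , x₂≢w = ⊥-elim fourth-edge-impossible
    where
    w≢x₁ : w ≢ x₁
    w≢x₁ = x₁≢w ∘ sym
    w≢x₂ : w ≢ x₂
    w≢x₂ = x₂≢w ∘ sym
    x₁∈e₃ : x₁ ∈ₑ e₃
    x₁∈e₃ = shared-endpoint-avoiding e₁ e₃ e₁e₃ w≢x₁ w∈e₁ x₁∈e₁ w∉e₃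
    x₂∈e₃ : x₂ ∈ₑ e₃
    x₂∈e₃ = shared-endpoint-avoiding e₂ e₃ e₂e₃ w≢x₂ w∈e₂ x₂∈e₂ w∉e₃
    x₁≢x₂ : x₁ ≢ x₂
    x₁≢x₂ refl = adjacent⇒≢ L e₁e₂ (edge-unique e₁ e₂ w≢x₁ w∈e₁ x₁∈e₁ w∈e₂ x₂∈e₂)
    fourth-edge-impossible : ⊥
    fourth-edge-impossible with adjacent⇒common-endpoint e₁ e₄ e₁e₄
    ... | z , z∈e₁ , z∈e₄ with endpoint-cases e₁ w≢x₁ w∈e₁ x₁∈e₁ z∈e₁
    ...   | inj₁ refl with adjacent⇒common-endpoint e₃ e₄ e₃e₄
    ...     | y , y∈e₃ , y∈e₄ with endpoint-cases e₃ x₁≢x₂ x₁∈e₃ x₂∈e₃ y∈e₃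
    ...       | inj₁ refl = adjacent⇒≢ L e₁e₄ (edge-unique e₁ e₄ w≢x₁ w∈e₁ x₁∈e₁ z∈e₄ y∈e₄)
    ...       | inj₂ refl = adjacent⇒≢ L e₂e₄ (edge-unique e₂ e₄ w≢x₂ w∈e₂ x₂∈e₂ z∈e₄ y∈e₄)
    fourth-edge-impossible | z , z∈e₁ , z∈e₄ | inj₂ refl with adjacent⇒common-endpoint e₂ e₄ e₂e₄
    ...     | y , y∈e₂ , y∈e₄ with endpoint-cases e₂ w≢x₂ w∈e₂ x₂∈e₂ y∈e₂
    ...       | inj₁ refl = adjacent⇒≢ L e₁e₄ (edge-unique e₁ e₄ w≢x₁ w∈e₁ x₁∈e₁ y∈e₄ z∈e₄)
    ...       | inj₂ refl = adjacent⇒≢ L e₃e₄ (edge-unique e₃ e₄ x₁≢x₂ x₁∈e₃ x₂∈e₃ z∈e₄ y∈e₄)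

  module Star (x : Fin n) {k} (neighbour : Fin k → Fin n) (adjacent : ∀ i → T (a x (neighbour i)))
              (injective : ∀ {i j} → neighbour i ≡ neighbour j → i ≡ j) where

    star : Fin k → Edge
    star i = proj₁ (edge-between x (neighbour i) (adjacent i))

    x∈star : ∀ i → x ∈ₑ star i
    x∈star i = proj₁ (proj₂ (edge-between x (neighbour i) (adjacent i)))

    neighbour∈star : ∀ i → neighbour i ∈ₑ star i
    neighbour∈star i = proj₂ (proj₂ (edge-between x (neighbour i) (adjacent i)))

    x≢neighbour : ∀ i → x ≢ neighbour i
    x≢neighbour i refl = a-irrefl (adjacent i)

    star-injective : ∀ {i j} → star i ≡ star j → i ≡ j
    star-injective {i} {j} eq with endpoint-cases (star i) (x≢neighbour i) (x∈star i) (neighbour∈star i)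
                                      (subst (neighbour j ∈ₑ_) (sym eq) (neighbour∈star j))
    ... | inj₁ nj≡x = ⊥-elim (x≢neighbour j (sym nj≡x))
    ... | inj₂ nj≡ni = injective (sym nj≡ni)

    star-adjacent : ∀ {i j} → i ≢ j → Adj L (star i) (star j)
    star-adjacent i≢j = common-endpoint⇒adjacent (i≢j ∘ star-injective) (x∈star _) (x∈star _)

    opaque
      star-complete : (∀ y → T (a x y) → Σ (Fin k) λ i → neighbour i ≡ y) →
                      ∀ e → x ∈ₑ e → Σ (Fin k) λ i → star i ≡ e
      star-complete surjective e x∈e with other-endpoint e x∈e
      ... | y , y∈e , y≢x with surjective y (endpoints-adjacent e (y≢x ∘ sym) x∈e y∈e)
      ...   | i , refl = i , edge-unique (star i) e (x≢neighbour i) (x∈star i) (neighbour∈star i) x∈e y∈e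

  edge? : Fin n × Fin n → Maybe Edge
  edge? (u , v) with u Fin.<? v | T? (a u v)
  ... | yes u<v | yes auv = just ((u , v) , u<v , auv)
  ... | _ | _ = nothing

  edges : List Edge
  edges = mapMaybe edge? (cartesianProduct (allFin n) (allFin n))

  ∈-edges : ∀ e → e ∈ edges
  ∈-edges e@((u , v) , u<v , auv) =
    Any.mapMaybe⁺ edge? _ (Any.map⁺ (Any.map (λ {refl → found}) (∈-cartesianProduct⁺ (∈-allFin u) (∈-allFin v))))
    where
    found : Maybe.Any (e ≡_) (edge? (u , v))
    found with u Fin.<? v | T? (a u v)
    ... | yes _ | yes _ = Maybe.just (edge-≡ refl)
    ... | no u≮v | _ = ⊥-elim (u≮v u<v)
    ... | yes _ | no ¬auv = ⊥-elim (¬auv auv)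

-- Exhaustive search for endomorphisms

-- Backtracking over partial assignments ρ, pruning values that break adjacency with the vertices assigned
-- so far; a homomorphism is never pruned, so the checks at the leaves cover every endomorphism.
module EndomorphismSearch {X : Set} (_≟_ : DecidableEquality X) (A : X → X → Bool)
                          (xs : List X) (complete : ∀ x → x ∈ xs) where

  IsHom : (X → X) → Set
  IsHom g = ∀ x y → T (A x y) → T (A (g x) (g y))

  SurjectiveReflecting : (X → X) → Set
  SurjectiveReflecting g = All (λ y → Any (λ x → g x ≡ y) xs) xs × All (λ x → All (λ y → T (A (g x) (g y)) → T (A x y)) xs) xs

  surjectiveReflecting? : ∀ g → Dec (SurjectiveReflecting g)
  surjectiveReflecting? g = All.all? (λ y → Any.any? (λ x → g x ≟ y) xs) xs
                      ×-dec All.all? (λ x → All.all? (λ y → T? (A (g x) (g y)) →-dec T? (A x y)) xs) xs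

  _[_↦_] : (X → X) → X → X → X → X
  (ρ [ x ↦ v ]) y = if isYes (y ≟ x) then v else ρ y

  _⇒ᵇ_ : Bool → Bool → Bool
  true ⇒ᵇ c = c
  false ⇒ᵇ c = true

  ⇒ᵇ-intro : ∀ {b c} → (T b → T c) → T (b ⇒ᵇ c)
  ⇒ᵇ-intro {true} b→c = b→c _
  ⇒ᵇ-intro {false} _ = _

  ⇒ᵇ-elim : ∀ {b c} → T (b ⇒ᵇ c) → T b → T c
  ⇒ᵇ-elim {true} c _ = c

  consistent : (X → X) → List X → X → X → Bool
  consistent ρ assigned x v = all (λ y → A x y ⇒ᵇ A v (ρ y)) assigned

  search : List X → List X → (X → X) → Bool
  search [] assigned ρ = isYes (surjectiveReflecting? ρ)
  search (x ∷ todo) assigned ρ = all (λ v → consistent ρ assigned x v ⇒ᵇ search todo (x ∷ assigned) (ρ [ x ↦ v ])) xs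

  module _ (g : X → X) (g-hom : IsHom g) where

    search-sound : ∀ todo assigned ρ → (∀ y → y ∈ todo ⊎ y ∈ assigned) → All (λ y → ρ y ≡ g y) assigned →
                   T (search todo assigned ρ) → SurjectiveReflecting g
    search-sound [] assigned ρ covered agrees found with toWitness found
    ... | hits , reflects = All.map (Any.map λ {ρx≡y → trans (sym (agree _)) ρx≡y}) hits ,
                            All.map (All.map λ {r a → r (subst₂ (λ u v → T (A u v)) (sym (agree _)) (sym (agree _)) a)}) reflects
      where
      agree : ∀ y → ρ y ≡ g y
      agree y with covered y
      ... | inj₂ y∈assigned = All.lookup agrees y∈assigned
    search-sound (x ∷ todo) assigned ρ covered agrees found =
      search-sound todo (x ∷ assigned) (ρ [ x ↦ g x ]) covered′ agrees′
                   (⇒ᵇ-elim (All.lookup (all⁺ _ xs found) (complete (g x))) g-consistent)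
      where
      g-consistent : T (consistent ρ assigned x (g x))
      g-consistent = all⁻ _ (All.tabulate λ y∈ → ⇒ᵇ-intro λ a →
                       subst (λ z → T (A (g x) z)) (sym (All.lookup agrees y∈)) (g-hom _ _ a))
      covered′ : ∀ y → y ∈ todo ⊎ y ∈ x ∷ assigned
      covered′ y with covered y
      ... | inj₁ (here refl) = inj₂ (here refl)
      ... | inj₁ (there y∈todo) = inj₁ y∈todo
      ... | inj₂ y∈assigned = inj₂ (there y∈assigned)
      updated : ∀ y → y ∈ x ∷ assigned → (ρ [ x ↦ g x ]) y ≡ g y
      updated y y∈ with y ≟ x | y∈
      ... | yes refl | _ = refl
      ... | no y≢x | here y≡x = ⊥-elim (y≢x y≡x)
      ... | no _ | there y∈assigned = All.lookup agrees y∈assigned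
      agrees′ : All (λ y → (ρ [ x ↦ g x ]) y ≡ g y) (x ∷ assigned)
      agrees′ = All.tabulate (updated _)

  opaque
    homomorphisms-surjective-reflecting : T (search xs [] (λ x → x)) → ∀ g → IsHom g →
      (∀ y → ∃ λ x → g x ≡ y) × (∀ x y → T (A (g x) (g y)) → T (A x y))
    homomorphisms-surjective-reflecting found g g-hom
      with search-sound g g-hom xs [] (λ x → x) (λ y → inj₁ (complete y)) All.[] found
    ... | hits , reflects = (λ y → Any.satisfied (All.lookup hits (complete y))) ,
                            (λ x y → All.lookup (All.lookup reflects (complete x)) (complete y))

-- The dragon

reflects-elim : ∀ {A : Set} {b} → Reflects A b → T b → A
reflects-elim (ofʸ a) _ = a

reflects-intro : ∀ {A : Set} {b} → Reflects A b → A → T b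
reflects-intro (ofʸ _) _ = tt
reflects-intro (ofⁿ ¬a) a = ¬a a

≡ᵇ-reflects : ∀ m n → Reflects (m ≡ n) (m ≡ᵇ n)
≡ᵇ-reflects m n = proof (m ℕ.≟ n)

isZeroOne-reflects : ∀ m → Reflects (m ≤ 1) (isZeroOne m)
isZeroOne-reflects 0 = ofʸ z≤n
isZeroOne-reflects 1 = ofʸ (s≤s z≤n)
isZeroOne-reflects (suc (suc m)) = ofⁿ λ {(s≤s ())}

DragonAdjacentℕ : ℕ → ℕ → ℕ → Set
DragonAdjacentℕ d a b = a ≢ b × ¬ (a ≤ 1 × b ≤ 1) × (a ≡ suc d → b ≤ 1) × (b ≡ suc d → a ≤ 1)

suc≰1 : ∀ {d} → 1 ≤ d → ¬ suc d ≤ 1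
suc≰1 1≤d (s≤s d≤0) = ℕ.<⇒≱ 1≤d d≤0

dragonAdjℕ-reflects : ∀ {d} → 1 ≤ d → ∀ a b → Reflects (DragonAdjacentℕ d a b) (dragonAdjℕ d a b)
dragonAdjℕ-reflects {d} 1≤d a b with a ≡ᵇ b | ≡ᵇ-reflects a b
... | true | ofʸ refl = ofⁿ λ adj → proj₁ adj refl
... | false | ofⁿ a≢b with a ≡ᵇ suc d | ≡ᵇ-reflects a (suc d)
...   | true | ofʸ refl with isZeroOne b | isZeroOne-reflects b
...     | true | ofʸ b≤1 = ofʸ (a≢b , suc≰1 1≤d ∘ proj₁ , const b≤1 , λ {refl → ⊥-elim (suc≰1 1≤d b≤1)})
...     | false | ofⁿ b≰1 = ofⁿ λ adj → b≰1 (proj₁ (proj₂ (proj₂ adj)) refl)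
dragonAdjℕ-reflects {d} 1≤d a b | false | ofⁿ a≢b | false | ofⁿ a≢t with b ≡ᵇ suc d | ≡ᵇ-reflects b (suc d)
...     | true | ofʸ refl with isZeroOne a | isZeroOne-reflects a
...       | true | ofʸ a≤1 = ofʸ (a≢b , suc≰1 1≤d ∘ proj₂ , ⊥-elim ∘ a≢t , const a≤1)
...       | false | ofⁿ a≰1 = ofⁿ λ adj → a≰1 (proj₂ (proj₂ (proj₂ adj)) refl)
dragonAdjℕ-reflects {d} 1≤d a b | false | ofⁿ a≢b | false | ofⁿ a≢t | false | ofⁿ b≢t
  with isZeroOne a ∧ isZeroOne b | isZeroOne-reflects a ×-reflects isZeroOne-reflects b
... | true | ofʸ both-low = ofⁿ λ adj → proj₁ (proj₂ adj) both-low
... | false | ofⁿ ¬both-low = ofʸ (a≢b , ¬both-low , ⊥-elim ∘ a≢t , ⊥-elim ∘ b≢t)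

module Dragon (d : ℕ) (1≤d : 1 ≤ d) where

  Vertex : Set
  Vertex = Fin (suc (suc d))

  -- the vertex subdividing the edge {0, 1}
  tip : Vertex
  tip = fromℕ (suc d)

  Low : Vertex → Set
  Low x = toℕ x ≤ 1

  Adjacent : Vertex → Vertex → Set
  Adjacent x y = x ≢ y × ¬ (Low x × Low y) × (x ≡ tip → Low y) × (y ≡ tip → Low x)

  private
    toℕ-tip : toℕ tip ≡ suc d
    toℕ-tip = Fin.toℕ-fromℕ (suc d)

    ≡tip : ∀ {x} → toℕ x ≡ suc d → x ≡ tip
    ≡tip eq = Fin.toℕ-injective (trans eq (sym toℕ-tip))

  adjacent⇒ : ∀ x y → T (dragonAdj d x y) → Adjacent x y
  adjacent⇒ x y axy with reflects-elim (dragonAdjℕ-reflects 1≤d (toℕ x) (toℕ y)) axy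
  ... | x≢y , ¬low , x-tip , y-tip = x≢y ∘ cong toℕ , ¬low , x-tip ∘ tip-toℕ , y-tip ∘ tip-toℕ
    where
    tip-toℕ : ∀ {z} → z ≡ tip → toℕ z ≡ suc d
    tip-toℕ refl = toℕ-tip

  ⇒adjacent : ∀ x y → Adjacent x y → T (dragonAdj d x y)
  ⇒adjacent x y (x≢y , ¬low , x-tip , y-tip) =
    reflects-intro (dragonAdjℕ-reflects 1≤d (toℕ x) (toℕ y)) (x≢y ∘ Fin.toℕ-injective , ¬low , x-tip ∘ ≡tip , y-tip ∘ ≡tip)

  adjacent-sym : ∀ x y → T (dragonAdj d x y) → T (dragonAdj d y x)
  adjacent-sym x y axy with adjacent⇒ x y axy
  ... | x≢y , ¬low , x-tip , y-tip = ⇒adjacent y x (x≢y ∘ sym , ¬low ∘ swap , y-tip , x-tip)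

  adjacent-irrefl : ∀ x → ¬ T (dragonAdj d x x)
  adjacent-irrefl x axx = proj₁ (adjacent⇒ x x axx) refl

  open LineGraphProperties (dragonAdj d) (λ {x} {y} → adjacent-sym x y) (λ {x} → adjacent-irrefl x) public

  tip-not-low : ¬ Low tip
  tip-not-low = suc≰1 1≤d ∘ subst (_≤ 1) toℕ-tip

  low⇒≢tip : ∀ {z} → Low z → z ≢ tip
  low⇒≢tip low refl = tip-not-low low

  low-cases : ∀ {z} → Low z → z ≡ 0F ⊎ z ≡ 1F
  low-cases {0F} _ = inj₁ refl
  low-cases {1F} _ = inj₂ refl
  low-cases {Fin.suc (Fin.suc _)} (s≤s ())

  low-adjacent-tip : ∀ {z} → Low z → T (dragonAdj d z tip)
  low-adjacent-tip {z} low = ⇒adjacent z tip (low⇒≢tip low , tip-not-low ∘ proj₂ , ⊥-elim ∘ low⇒≢tip low , const low)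

  tip-neighbour-low : ∀ {y} → T (dragonAdj d tip y) → Low y
  tip-neighbour-low {y} a = proj₁ (proj₂ (proj₂ (adjacent⇒ tip y a))) refl

  tip-edge₀ : Σ Edge λ e → 0F ∈ₑ e × tip ∈ₑ e
  tip-edge₀ = edge-between 0F tip (low-adjacent-tip z≤n)

  tip-edge₁ : Σ Edge λ e → 1F ∈ₑ e × tip ∈ₑ e
  tip-edge₁ = edge-between 1F tip (low-adjacent-tip (s≤s z≤n))

  e₀ e₁ : Edge
  e₀ = proj₁ tip-edge₀
  e₁ = proj₁ tip-edge₁

  tip-edge-cases : ∀ {e} → tip ∈ₑ e → e ≡ e₀ ⊎ e ≡ e₁
  tip-edge-cases {e} tip∈e with other-endpoint e tip∈e
  ... | y , y∈e , y≢tip with low-cases (tip-neighbour-low (endpoints-adjacent e (y≢tip ∘ sym) tip∈e y∈e))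
  ...   | inj₁ refl = inj₁ (edge-unique e e₀ (y≢tip ∘ sym) tip∈e y∈e (proj₂ (proj₂ tip-edge₀)) (proj₁ (proj₂ tip-edge₀)))
  ...   | inj₂ refl = inj₂ (edge-unique e e₁ (y≢tip ∘ sym) tip∈e y∈e (proj₂ (proj₂ tip-edge₁)) (proj₁ (proj₂ tip-edge₁)))

  first-endpoint≢tip : ∀ (e : Edge) → proj₁ (proj₁ e) ≢ tip
  first-endpoint≢tip ((u , v) , u<v , _) refl = ℕ.<⇒≱ (subst (ℕ._< toℕ v) toℕ-tip u<v) (ℕ.≤-pred (Fin.toℕ<n v))

  record NeighbourEnumeration (x : Vertex) : Set where
    field
      neighbour  : Fin d → Vertex
      adjacent   : ∀ i → T (dragonAdj d x (neighbour i))
      injective  : ∀ {i j} → neighbour i ≡ neighbour j → i ≡ j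
      surjective : ∀ y → T (dragonAdj d x y) → Σ (Fin d) λ i → neighbour i ≡ y

  opaque
    -- A low vertex sees 2, ..., d and the tip; any other vertex x ≠ tip sees 0, ..., d except itself.
    neighbours : ∀ x → x ≢ tip → NeighbourEnumeration x
    neighbours x x≢tip with toℕ x ℕ.≤? 1
    ... | yes low = record
      { neighbour  = Fin.suc ∘ Fin.suc
      ; adjacent   = λ i → ⇒adjacent x _ ((λ {refl → high i low}) , high i ∘ proj₂ , ⊥-elim ∘ x≢tip , const low)
      ; injective  = Fin.suc-injective ∘ Fin.suc-injective
      ; surjective = λ where
          Fin.zero axy → ⊥-elim (proj₁ (proj₂ (adjacent⇒ x _ axy)) (low , z≤n))
          (Fin.suc Fin.zero) axy → ⊥-elim (proj₁ (proj₂ (adjacent⇒ x _ axy)) (low , s≤s z≤n))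
          (Fin.suc (Fin.suc i)) _ → i , refl
      }
      where
      high : ∀ i → ¬ Low (Fin.suc (Fin.suc i))
      high i (s≤s ())
    ... | no high = record
      { neighbour  = neighbour
      ; adjacent   = λ i → ⇒adjacent x (neighbour i)
                       (x≢neighbour i , high ∘ proj₁ , ⊥-elim ∘ x≢tip , ⊥-elim ∘ Fin.fromℕ≢inject₁ ∘ sym)
      ; injective  = Fin.punchIn-injective x′ _ _ ∘ Fin.inject₁-injective
      ; surjective = surjective
      }
      where
      x′ : Fin (suc d)
      x′ = Fin.lower₁ x (x≢tip ∘ ≡tip ∘ sym)
      neighbour : Fin d → Vertex
      neighbour i = Fin.inject₁ (Fin.punchIn x′ i)
      x≢neighbour : ∀ i → x ≢ neighbour i
      x≢neighbour i x≡ni = Fin.punchInᵢ≢i x′ i (Fin.inject₁-injective (trans (sym x≡ni) (sym (Fin.inject₁-lower₁ x _))))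
      surjective : ∀ y → T (dragonAdj d x y) → Σ (Fin d) λ i → neighbour i ≡ y
      surjective y axy = Fin.punchOut x′≢y′ , trans (cong Fin.inject₁ (Fin.punchIn-punchOut x′≢y′)) (Fin.inject₁-lower₁ y _)
        where
        y′ : Fin (suc d)
        y′ = Fin.lower₁ y (high ∘ proj₂ (proj₂ (proj₂ (adjacent⇒ x y axy))) ∘ ≡tip ∘ sym)
        x′≢y′ : x′ ≢ y′
        x′≢y′ eq = proj₁ (adjacent⇒ x y axy)
          (trans (sym (Fin.inject₁-lower₁ x _)) (trans (cong Fin.inject₁ eq) (Fin.inject₁-lower₁ y _)))

  module StarAt (x : Vertex) (x≢tip : x ≢ tip) where
    open NeighbourEnumeration (neighbours x x≢tip)
    open Star x neighbour adjacent injective public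

    star-surjective : ∀ e → x ∈ₑ e → Σ (Fin d) λ i → star i ≡ e
    star-surjective = star-complete surjective

  low-pair : ∀ {a b x} → Low a → Low b → a ≢ b → Low x → x ≡ a ⊎ x ≡ b
  low-pair low-a low-b a≢b low-x with low-cases low-a | low-cases low-b | low-cases low-x
  ... | inj₁ refl | inj₁ refl | _ = ⊥-elim (a≢b refl)
  ... | inj₂ refl | inj₂ refl | _ = ⊥-elim (a≢b refl)
  ... | inj₁ refl | inj₂ refl | inj₁ refl = inj₁ refl
  ... | inj₁ refl | inj₂ refl | inj₂ refl = inj₂ refl
  ... | inj₂ refl | inj₁ refl | inj₁ refl = inj₂ refl
  ... | inj₂ refl | inj₁ refl | inj₂ refl = inj₁ refl

  adjacency-reflected : ∀ (σ : Vertex → Vertex) → (∀ {x} → x ≡ tip → σ x ≡ tip) →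
    (∀ {x} → Low x → Low (σ x)) → (∀ {x} → Low (σ x) → Low x) →
    ∀ x y → T (dragonAdj d (σ x) (σ y)) → T (dragonAdj d x y)
  adjacency-reflected σ tip-fixed low-preserved low-reflected x y aσ with adjacent⇒ (σ x) (σ y) aσ
  ... | σx≢σy , ¬low , x-tip , y-tip =
    ⇒adjacent x y (σx≢σy ∘ cong σ , (λ (lx , ly) → ¬low (low-preserved lx , low-preserved ly)) ,
                   low-reflected ∘ x-tip ∘ tip-fixed , low-reflected ∘ y-tip ∘ tip-fixed)

-- Endomorphisms of L(D_d) for d ≥ 3

module Endomorphism (d′ : ℕ) (f : V (LineDragon (3 + d′)) → V (LineDragon (3 + d′)))
                    (f-hom : IsHomomorphism (LineDragon (3 + d′)) f) where

  open Dragon (3 + d′) (s≤s z≤n) public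

  f-distinct : ∀ e e' → Adj L e e' → f e ≢ f e'
  f-distinct e e' ee' = adjacent⇒≢ L (f-hom {e} {e'} ee')

  no-collision : ∀ {x z z'} e e' → e ≢ e' → x ∈ₑ e → x ∈ₑ e' → z ≢ z' →
                 z ∈ₑ f e → z' ∈ₑ f e → z ∈ₑ f e' → z' ∈ₑ f e' → ⊥
  no-collision e e' e≢e' x∈e x∈e' z≢z' z∈fe z'∈fe z∈fe' z'∈fe' =
    f-distinct e e' (common-endpoint⇒adjacent e≢e' x∈e x∈e') (edge-unique (f e) (f e') z≢z' z∈fe z'∈fe z∈fe' z'∈fe')

  module _ {x} (x≢tip : x ≢ tip) where
    open StarAt x x≢tip

    f-star-distinct : ∀ {i j} → i ≢ j → f (star i) ≢ f (star j)
    f-star-distinct i≢j = f-distinct _ _ (star-adjacent i≢j)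

  module CommonEndpoint {w} (w≢tip : w ≢ tip) (w∈f : ∀ e → w ∈ₑ f e) where
    private module W = StarAt w w≢tip

    opaque
      -- f maps the star at x injectively into the star at w, and both have d edges.
      preimage-at : ∀ {x} → x ≢ tip → ∀ {h} → w ∈ₑ h → Σ Edge λ e → x ∈ₑ e × f e ≡ h
      preimage-at {x} x≢tip {h} w∈h = X.star i , X.x∈star i , (begin
        f (X.star i)   ≡⟨ proj₂ (W.star-surjective _ (w∈f (X.star i))) ⟨
        W.star (slot i) ≡⟨ cong W.star slot-i≡k ⟩
        W.star k       ≡⟨ proj₂ (W.star-surjective h w∈h) ⟩
        h ∎)
        where
        open ≡-Reasoning
        module X = StarAt x x≢tip
        slot : Fin (3 + d′) → Fin (3 + d′)
        slot i = proj₁ (W.star-surjective (f (X.star i)) (w∈f (X.star i)))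
        slot-injective : ∀ {i j} → slot i ≡ slot j → i ≡ j
        slot-injective {i} {j} eq = decidable-stable (i Fin.≟ j) λ i≢j → f-star-distinct x≢tip i≢j (begin
          f (X.star i)    ≡⟨ proj₂ (W.star-surjective _ (w∈f (X.star i))) ⟨
          W.star (slot i) ≡⟨ cong W.star eq ⟩
          W.star (slot j) ≡⟨ proj₂ (W.star-surjective _ (w∈f (X.star j))) ⟩
          f (X.star j) ∎)
        k : Fin (3 + d′)
        k = proj₁ (W.star-surjective h w∈h)
        i : Fin (3 + d′)
        i = proj₁ (injective⇒surjective slot slot-injective k)
        slot-i≡k : slot i ≡ k
        slot-i≡k = proj₂ (injective⇒surjective slot slot-injective k)

    module Matching {h} (w∈h : w ∈ₑ h) where

      Matched : Vertex → Vertex → Set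
      Matched x y = Σ Edge λ e → x ∈ₑ e × y ∈ₑ e × x ≢ y × f e ≡ h

      matched-sym : ∀ {x y} → Matched x y → Matched y x
      matched-sym (e , x∈e , y∈e , x≢y , fe≡h) = e , y∈e , x∈e , x≢y ∘ sym , fe≡h

      matched-unique : ∀ {x y y'} → Matched x y → Matched x y' → y ≡ y'
      matched-unique {x} {y} {y'} (e , x∈e , y∈e , x≢y , fe≡h) (e' , x∈e' , y'∈e' , x≢y' , fe'≡h) with y Fin.≟ y'
      ... | yes y≡y' = y≡y'
      ... | no y≢y' = ⊥-elim (f-distinct e e' (common-endpoint⇒adjacent e≢e' x∈e x∈e') (trans fe≡h (sym fe'≡h)))
        where
        e≢e' : e ≢ e'
        e≢e' refl with endpoint-cases e x≢y x∈e y∈e y'∈e'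
        ... | inj₁ y'≡x = x≢y' (sym y'≡x)
        ... | inj₂ y'≡y = y≢y' (sym y'≡y)

      Unmatched : Vertex → Set
      Unmatched x = ∀ y → ¬ Matched x y

      opaque
        matching : ∀ x → Σ Vertex λ y → Matched x y ⊎ (x ≡ tip × y ≡ tip × Unmatched tip)
        matching x with x Fin.≟ tip
        ... | no x≢tip with preimage-at x≢tip w∈h
        ...   | e , x∈e , fe≡h with other-endpoint e x∈e
        ...     | y , y∈e , y≢x = y , inj₁ (e , x∈e , y∈e , y≢x ∘ sym , fe≡h)
        matching x | yes refl with f e₀ ≟ₑ h | f e₁ ≟ₑ h
        ... | yes fe₀≡h | _ = _ , inj₁ (e₀ , proj₂ (proj₂ tip-edge₀) , proj₁ (proj₂ tip-edge₀) , (λ ()) , fe₀≡h)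
        ... | no _ | yes fe₁≡h = _ , inj₁ (e₁ , proj₂ (proj₂ tip-edge₁) , proj₁ (proj₂ tip-edge₁) , (λ ()) , fe₁≡h)
        ... | no fe₀≢h | no fe₁≢h = tip , inj₂ (refl , refl , unmatched)
          where
          unmatched : Unmatched tip
          unmatched y (e , tip∈e , _ , _ , fe≡h) with tip-edge-cases tip∈e
          ... | inj₁ e≡e₀ = fe₀≢h (trans (cong f (sym e≡e₀)) fe≡h)
          ... | inj₂ e≡e₁ = fe₁≢h (trans (cong f (sym e≡e₁)) fe≡h)

      partner : Vertex → Vertex
      partner x = proj₁ (matching x)

      partner-spec : ∀ x → Matched x (partner x) ⊎ (x ≡ tip × partner x ≡ tip × Unmatched tip)
      partner-spec x = proj₂ (matching x)

      partner-involutive : ∀ x → partner (partner x) ≡ x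
      partner-involutive x with partner-spec x
      ... | inj₂ (x≡tip , px≡tip , _) = let px≡x = trans px≡tip (sym x≡tip) in trans (cong partner px≡x) px≡x
      ... | inj₁ x~px with partner-spec (partner x)
      ...   | inj₁ px~ppx = matched-unique px~ppx (matched-sym x~px)
      ...   | inj₂ (px≡tip , _ , unmatched) = ⊥-elim (unmatched x (subst (λ z → Matched z x) px≡tip (matched-sym x~px)))

      partner-fixed : ∀ {x} → partner x ≡ x → x ≡ tip × Unmatched tip
      partner-fixed {x} px≡x with partner-spec x
      ... | inj₁ (_ , _ , _ , x≢px , _) = ⊥-elim (x≢px (sym px≡x))
      ... | inj₂ (x≡tip , _ , unmatched) = x≡tip , unmatched

    opaque
      avoiding-edge : Σ Edge λ h → w ∈ₑ h × f e₀ ≢ h × f e₁ ≢ h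
      avoiding-edge = try 0F λ hit₀ → try 1F λ hit₁ → try 2F λ hit₂ →
        ⊥-elim (three-into-two (distinct {0F} {1F} (λ ())) (distinct {0F} {2F} (λ ())) (distinct {1F} {2F} (λ ())) hit₀ hit₁ hit₂)
        where
        distinct : ∀ {i j} → i ≢ j → W.star i ≢ W.star j
        distinct i≢j = i≢j ∘ W.star-injective
        try : ∀ i → (W.star i ≡ f e₀ ⊎ W.star i ≡ f e₁ → Σ Edge λ h → w ∈ₑ h × f e₀ ≢ h × f e₁ ≢ h) →
                Σ Edge λ h → w ∈ₑ h × f e₀ ≢ h × f e₁ ≢ h
        try i otherwise with f e₀ ≟ₑ W.star i | f e₁ ≟ₑ W.star i
        ... | yes fe₀≡ | _ = otherwise (inj₁ (sym fe₀≡))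
        ... | no _ | yes fe₁≡ = otherwise (inj₂ (sym fe₁≡))
        ... | no fe₀≢ | no fe₁≢ = W.star i , W.x∈star i , fe₀≢ , fe₁≢

    impossible : ⊥
    impossible =
      let k , 2k≡n = fixed-point-free⇒even M₀.partner M₀.partner-involutive partner₀-fixed-point-free
          k′ , 1+2k′≡n = unique-fixed-point⇒odd M₁.partner M₁.partner-involutive partner₁-tip (λ _ → proj₁ ∘ M₁.partner-fixed)
      in ℕ.even≢odd k k′ (trans 2k≡n (sym 1+2k′≡n))
      where
      module M₀ = Matching (w∈f e₀)
      module M₁ = Matching (proj₁ (proj₂ avoiding-edge))
      partner₀-fixed-point-free : ∀ x → M₀.partner x ≢ x
      partner₀-fixed-point-free x px≡x =
        proj₂ (M₀.partner-fixed px≡x) 0F (e₀ , proj₂ (proj₂ tip-edge₀) , proj₁ (proj₂ tip-edge₀) , (λ ()) , refl)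
      partner₁-tip : M₁.partner tip ≡ tip
      partner₁-tip with M₁.partner-spec tip
      ... | inj₂ (_ , p-tip≡tip , _) = p-tip≡tip
      ... | inj₁ (e , tip∈e , _ , _ , fe≡h) with tip-edge-cases tip∈e
      ...   | inj₁ e≡e₀ = ⊥-elim (proj₁ (proj₂ (proj₂ avoiding-edge)) (trans (cong f (sym e≡e₀)) fe≡h))
      ...   | inj₂ e≡e₁ = ⊥-elim (proj₂ (proj₂ (proj₂ avoiding-edge)) (trans (cong f (sym e≡e₁)) fe≡h))

  no-common-endpoint : ∀ {w} → w ≢ tip → ¬ (∀ e → w ∈ₑ f e)
  no-common-endpoint w≢tip w∈f = CommonEndpoint.impossible w≢tip w∈f

  Mid : Vertex → Set
  Mid x = ¬ Low x × x ≢ tip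

  mid-adjacent : ∀ {x y} → Mid x → y ≢ tip → x ≢ y → T (dragonAdj (3 + d′) x y)
  mid-adjacent {x} {y} (high , x≢tip) y≢tip x≢y = ⇒adjacent x y (x≢y , high ∘ proj₁ , ⊥-elim ∘ x≢tip , ⊥-elim ∘ y≢tip)

  mid₂ : Mid 2F
  mid₂ = (λ {(s≤s ())}) , λ ()

  mid₃ : Mid 3F
  mid₃ = (λ {(s≤s ())}) , λ ()

  module StarCentres (σ : Vertex → Vertex) (σ-tip : σ tip ≡ tip)
                   (σ-endpoint : ∀ {x} → x ≢ tip → ∀ {e} → x ∈ₑ e → σ x ∈ₑ f e) where

    -- The three edges 0, 1, 2 of the star at x would map to distinct edges through the tip, which has degree 2.
    σ-avoids-tip : ∀ {x} → x ≢ tip → σ x ≢ tip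
    σ-avoids-tip x≢tip σx≡tip =
      three-into-two (f-star-distinct x≢tip (λ ())) (f-star-distinct x≢tip (λ ())) (f-star-distinct x≢tip (λ ()))
                     (through-tip 0F) (through-tip 1F) (through-tip 2F)
      where
      open StarAt _ x≢tip
      through-tip : ∀ i → f (star i) ≡ e₀ ⊎ f (star i) ≡ e₁
      through-tip i = tip-edge-cases (subst (_∈ₑ f (star i)) σx≡tip (σ-endpoint x≢tip (x∈star i)))

    σ-agrees-at-common-neighbour : ∀ {x u v} → u ≢ v → x ≢ tip → u ≢ tip → v ≢ tip →
      T (dragonAdj (3 + d′) x u) → T (dragonAdj (3 + d′) x v) → σ u ≡ σ v → σ x ≡ σ u
    σ-agrees-at-common-neighbour {x} {u} {v} u≢v x≢tip u≢tip v≢tip xu xv σu≡σv with σ x Fin.≟ σ u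
    ... | yes σx≡σu = σx≡σu
    ... | no σx≢σu = ⊥-elim (no-collision e e' e≢e' x∈e x∈e' σx≢σu (σ-endpoint x≢tip x∈e) (σ-endpoint u≢tip u∈e)
                                          (σ-endpoint x≢tip x∈e') (subst (_∈ₑ f e') (sym σu≡σv) (σ-endpoint v≢tip v∈e')))
      where
      e e' : Edge
      e = proj₁ (edge-between x u xu)
      e' = proj₁ (edge-between x v xv)
      x∈e : x ∈ₑ e
      x∈e = proj₁ (proj₂ (edge-between x u xu))
      u∈e : u ∈ₑ e
      u∈e = proj₂ (proj₂ (edge-between x u xu))
      x∈e' : x ∈ₑ e'
      x∈e' = proj₁ (proj₂ (edge-between x v xv))
      v∈e' : v ∈ₑ e'
      v∈e' = proj₂ (proj₂ (edge-between x v xv))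
      e≢e' : e ≢ e'
      e≢e' e≡e' with endpoint-cases e (λ {refl → adjacent-irrefl x xu}) x∈e u∈e (subst (v ∈ₑ_) (sym e≡e') v∈e')
      ... | inj₁ refl = adjacent-irrefl x xv
      ... | inj₂ v≡u = u≢v (sym v≡u)

    module _ {u v} (u≢v : u ≢ v) (u≢tip : u ≢ tip) (v≢tip : v ≢ tip) (σu≡σv : σ u ≡ σ v) where

      σ-collapses-on-mid : ∀ {y} → Mid y → σ y ≡ σ u
      σ-collapses-on-mid {y} mid-y with y Fin.≟ u | y Fin.≟ v
      ... | yes refl | _ = refl
      ... | no _ | yes refl = sym σu≡σv
      ... | no y≢u | no y≢v = σ-agrees-at-common-neighbour u≢v (proj₂ mid-y) u≢tip v≢tip
                                (mid-adjacent mid-y u≢tip y≢u) (mid-adjacent mid-y v≢tip y≢v) σu≡σv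

      σ-collapses : ∀ {x} → x ≢ tip → σ x ≡ σ u
      σ-collapses {x} x≢tip with Fin.toℕ x ℕ.≤? 1
      ... | no high = σ-collapses-on-mid (high , x≢tip)
      ... | yes low = trans (σ-agrees-at-common-neighbour (λ ()) x≢tip (λ ()) (λ ())
                               (adjacent-sym 2F x (mid-adjacent mid₂ x≢tip λ {refl → proj₁ mid₂ low}))
                               (adjacent-sym 3F x (mid-adjacent mid₃ x≢tip λ {refl → proj₁ mid₃ low}))
                               (trans (σ-collapses-on-mid mid₂) (sym (σ-collapses-on-mid mid₃))))
                            (σ-collapses-on-mid mid₂)

    σ-injective-off-tip : ∀ {u v} → u ≢ tip → v ≢ tip → σ u ≡ σ v → u ≡ v
    σ-injective-off-tip {u} {v} u≢tip v≢tip σu≡σv with u Fin.≟ v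
    ... | yes u≡v = u≡v
    ... | no u≢v = ⊥-elim (no-common-endpoint (σ-avoids-tip u≢tip) σu∈f)
      where
      σu∈f : ∀ e → σ u ∈ₑ f e
      σu∈f e = subst (_∈ₑ f e) (σ-collapses u≢v u≢tip v≢tip σu≡σv (first-endpoint≢tip e))
                     (σ-endpoint (first-endpoint≢tip e) (inj₁ refl))

    σ-injective : ∀ {x y} → σ x ≡ σ y → x ≡ y
    σ-injective {x} {y} σx≡σy with x Fin.≟ tip | y Fin.≟ tip
    ... | yes refl | yes refl = refl
    ... | yes refl | no y≢tip = ⊥-elim (σ-avoids-tip y≢tip (trans (sym σx≡σy) σ-tip))
    ... | no x≢tip | yes refl = ⊥-elim (σ-avoids-tip x≢tip (trans σx≡σy σ-tip))
    ... | no x≢tip | no y≢tip = σ-injective-off-tip x≢tip y≢tip σx≡σy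

    σ⁻¹ : Vertex → Vertex
    σ⁻¹ y = proj₁ (injective⇒surjective σ σ-injective y)

    σ∘σ⁻¹ : ∀ y → σ (σ⁻¹ y) ≡ y
    σ∘σ⁻¹ y = proj₂ (injective⇒surjective σ σ-injective y)

    σ⁻¹∘σ : ∀ x → σ⁻¹ (σ x) ≡ x
    σ⁻¹∘σ x = σ-injective (σ∘σ⁻¹ (σ x))

    σ⁻¹-avoids-tip : ∀ {y} → y ≢ tip → σ⁻¹ y ≢ tip
    σ⁻¹-avoids-tip {y} y≢tip σ⁻¹y≡tip = y≢tip (trans (sym (σ∘σ⁻¹ y)) (trans (cong σ σ⁻¹y≡tip) σ-tip))

    σ⁻¹0≢σ⁻¹1 : σ⁻¹ 0F ≢ σ⁻¹ 1F
    σ⁻¹0≢σ⁻¹1 eq with trans (sym (σ∘σ⁻¹ 0F)) (trans (cong σ eq) (σ∘σ⁻¹ 1F))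
    ... | ()

    -- Otherwise the preimages of 0 and 1 would span an edge whose image joins the non-adjacent vertices 0 and 1.
    ¬¬σ⁻¹-low : ¬ ¬ (Low (σ⁻¹ 0F) × Low (σ⁻¹ 1F))
    ¬¬σ⁻¹-low ¬low = proj₁ (proj₂ (adjacent⇒ 0F 1F (endpoints-adjacent (f e) (λ ()) 0∈fe 1∈fe))) (z≤n , s≤s z≤n)
      where
      between : Σ Edge λ e → σ⁻¹ 0F ∈ₑ e × σ⁻¹ 1F ∈ₑ e
      between = edge-between (σ⁻¹ 0F) (σ⁻¹ 1F)
        (⇒adjacent _ _ (σ⁻¹0≢σ⁻¹1 , ¬low , ⊥-elim ∘ σ⁻¹-avoids-tip (λ ()) , ⊥-elim ∘ σ⁻¹-avoids-tip (λ ())))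
      e : Edge
      e = proj₁ between
      0∈fe : 0F ∈ₑ f e
      0∈fe = subst (_∈ₑ f e) (σ∘σ⁻¹ 0F) (σ-endpoint (σ⁻¹-avoids-tip (λ ())) (proj₁ (proj₂ between)))
      1∈fe : 1F ∈ₑ f e
      1∈fe = subst (_∈ₑ f e) (σ∘σ⁻¹ 1F) (σ-endpoint (σ⁻¹-avoids-tip (λ ())) (proj₂ (proj₂ between)))

    σ⁻¹-low : Low (σ⁻¹ 0F) × Low (σ⁻¹ 1F)
    σ⁻¹-low = decidable-stable (Fin.toℕ (σ⁻¹ 0F) ℕ.≤? 1 ×-dec Fin.toℕ (σ⁻¹ 1F) ℕ.≤? 1) ¬¬σ⁻¹-low

    low-reflected : ∀ {x} → Low (σ x) → Low x
    low-reflected {x} low with low-cases low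
    ... | inj₁ σx≡0 = subst Low (trans (cong σ⁻¹ (sym σx≡0)) (σ⁻¹∘σ x)) (proj₁ σ⁻¹-low)
    ... | inj₂ σx≡1 = subst Low (trans (cong σ⁻¹ (sym σx≡1)) (σ⁻¹∘σ x)) (proj₂ σ⁻¹-low)

    low-preserved : ∀ {x} → Low x → Low (σ x)
    low-preserved low with low-pair (proj₁ σ⁻¹-low) (proj₂ σ⁻¹-low) σ⁻¹0≢σ⁻¹1 low
    ... | inj₁ refl = subst Low (sym (σ∘σ⁻¹ 0F)) z≤n
    ... | inj₂ refl = subst Low (sym (σ∘σ⁻¹ 1F)) (s≤s z≤n)

    -- The image of a tip edge e = {x, tip} contains σ x; were its other endpoint σ y with y ≠ tip, then y low
    -- makes two low vertices adjacent, and y high makes e and the edge {x, y} collide under f.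
    tip-endpoint : ∀ {e} → tip ∈ₑ e → tip ∈ₑ f e
    tip-endpoint {e} tip∈e with other-endpoint e tip∈e
    ... | x , x∈e , x≢tip with other-endpoint (f e) (σ-endpoint x≢tip x∈e)
    ...   | z , z∈fe , z≢σx with z Fin.≟ tip
    ...     | yes refl = z∈fe
    ...     | no z≢tip with Fin.toℕ (σ⁻¹ z) ℕ.≤? 1
    ...       | yes low = ⊥-elim (proj₁ (proj₂ (adjacent⇒ (σ x) z (endpoints-adjacent (f e) (z≢σx ∘ sym) (σ-endpoint x≢tip x∈e) z∈fe)))
                                    (low-preserved (tip-neighbour-low (endpoints-adjacent e (x≢tip ∘ sym) tip∈e x∈e)) ,
                                     subst Low (σ∘σ⁻¹ z) (low-preserved low)))
    ...       | no high = ⊥-elim (no-collision e e' e≢e' x∈e x∈e' (z≢σx ∘ sym) (σ-endpoint x≢tip x∈e) z∈fe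
                                               (σ-endpoint x≢tip x∈e') (subst (_∈ₑ f e') (σ∘σ⁻¹ z) (σ-endpoint y≢tip y∈e')))
      where
      y : Vertex
      y = σ⁻¹ z
      y≢tip : y ≢ tip
      y≢tip = σ⁻¹-avoids-tip z≢tip
      y≢x : y ≢ x
      y≢x y≡x = z≢σx (trans (sym (σ∘σ⁻¹ z)) (cong σ y≡x))
      between : Σ Edge λ e' → y ∈ₑ e' × x ∈ₑ e'
      between = edge-between y x (mid-adjacent (high , y≢tip) x≢tip y≢x)
      e' : Edge
      e' = proj₁ between
      y∈e' : y ∈ₑ e'
      y∈e' = proj₁ (proj₂ between)
      x∈e' : x ∈ₑ e'
      x∈e' = proj₂ (proj₂ between)
      e≢e' : e ≢ e'
      e≢e' refl with endpoint-cases e y≢x y∈e' x∈e' tip∈e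
      ... | inj₁ tip≡y = y≢tip (sym tip≡y)
      ... | inj₂ tip≡x = x≢tip (sym tip≡x)

    σ-endpoint-any : ∀ {z e} → z ∈ₑ e → σ z ∈ₑ f e
    σ-endpoint-any {z} {e} z∈e with z Fin.≟ tip
    ... | yes refl = subst (_∈ₑ f e) (sym σ-tip) (tip-endpoint z∈e)
    ... | no z≢tip = σ-endpoint z≢tip z∈e

    opaque
      preimage-edge : ∀ u v → T (dragonAdj (3 + d′) u v) → Σ Edge λ e → σ⁻¹ u ∈ₑ e × σ⁻¹ v ∈ₑ e
      preimage-edge u v auv = edge-between (σ⁻¹ u) (σ⁻¹ v)
        (adjacency-reflected σ (λ {refl → σ-tip}) low-preserved low-reflected _ _
          (subst₂ (λ x y → T (dragonAdj (3 + d′) x y)) (sym (σ∘σ⁻¹ u)) (sym (σ∘σ⁻¹ v)) auv))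

      section : Edge → Edge
      section ((u , v) , _ , auv) = proj₁ (preimage-edge u v auv)

      σ⁻¹-endpoint-section : ∀ {z e} → z ∈ₑ e → σ⁻¹ z ∈ₑ section e
      σ⁻¹-endpoint-section {e = (u , v) , _ , auv} (inj₁ refl) = proj₁ (proj₂ (preimage-edge u v auv))
      σ⁻¹-endpoint-section {e = (u , v) , _ , auv} (inj₂ refl) = proj₂ (proj₂ (preimage-edge u v auv))

    f∘section : ∀ e → f (section e) ≡ e
    f∘section e = edge-unique (f (section e)) e (endpoints-distinct e) (endpoint (inj₁ refl)) (endpoint (inj₂ refl)) (inj₁ refl) (inj₂ refl)
      where
      endpoint : ∀ {z} → z ∈ₑ e → z ∈ₑ f (section e)
      endpoint {z} z∈e = subst (_∈ₑ f (section e)) (σ∘σ⁻¹ z) (σ-endpoint-any (σ⁻¹-endpoint-section z∈e))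

    section-hom : IsHomomorphism L section
    section-hom {e} {e'} ee' =
      let z , z∈e , z∈e' = adjacent⇒common-endpoint e e' ee'
      in common-endpoint⇒adjacent {section e} {section e'} {σ⁻¹ z} section-distinct
           (σ⁻¹-endpoint-section z∈e) (σ⁻¹-endpoint-section z∈e')
      where
      section-distinct : section e ≢ section e'
      section-distinct eq = adjacent⇒≢ L ee' (trans (sym (f∘section e)) (trans (cong f eq) (f∘section e')))

module LargeEndomorphism (d″ : ℕ) (f : V (LineDragon (4 + d″)) → V (LineDragon (4 + d″)))
                         (f-hom : IsHomomorphism (LineDragon (4 + d″)) f) where

  open Endomorphism (suc d″) f f-hom

  star-image-centre : ∀ {x} → x ≢ tip → Σ Vertex λ w → ∀ {e} → x ∈ₑ e → w ∈ₑ f e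
  star-image-centre {x} x≢tip = w , λ {e} x∈e → centre (star-surjective e x∈e)
    where
    open StarAt x x≢tip
    f-star-adjacent : ∀ {i j} → i ≢ j → Adj L (f (star i)) (f (star j))
    f-star-adjacent {i} {j} i≢j = f-hom {star i} {star j} (star-adjacent i≢j)
    w∈f₀₁ : Σ Vertex λ w → w ∈ₑ f (star 0F) × w ∈ₑ f (star 1F)
    w∈f₀₁ = adjacent⇒common-endpoint (f (star 0F)) (f (star 1F)) (f-star-adjacent {0F} {1F} λ ())
    w : Vertex
    w = proj₁ w∈f₀₁
    through-third : ∀ {i j} → 0F ≢ i → 1F ≢ i → 0F ≢ j → 1F ≢ j → i ≢ j → w ∈ₑ f (star i)
    through-third {i} {j} 0≢i 1≢i 0≢j 1≢j i≢j =
      clique₄-common-endpoint (f (star 0F)) (f (star 1F)) (f (star i)) (f (star j))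
        (f-star-adjacent λ ()) (f-star-adjacent 0≢i) (f-star-adjacent 1≢i)
        (f-star-adjacent 0≢j) (f-star-adjacent 1≢j) (f-star-adjacent i≢j) (proj₁ (proj₂ w∈f₀₁)) (proj₂ (proj₂ w∈f₀₁))
    centre : ∀ {e} → Σ (Fin (4 + d″)) (λ i → star i ≡ e) → w ∈ₑ f e
    centre (0F , refl) = proj₁ (proj₂ w∈f₀₁)
    centre (1F , refl) = proj₂ (proj₂ w∈f₀₁)
    centre (2F , refl) = through-third {2F} {3F} (λ ()) (λ ()) (λ ()) (λ ()) (λ ())
    centre (Fin.suc (Fin.suc (Fin.suc i)) , refl) = through-third {Fin.suc (Fin.suc (Fin.suc i))} {2F} (λ ()) (λ ()) (λ ()) (λ ()) (λ ())

  σ : Vertex → Vertex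
  σ x with x Fin.≟ tip
  ... | yes _ = tip
  ... | no x≢tip = proj₁ (star-image-centre x≢tip)

  σ-tip : σ tip ≡ tip
  σ-tip with tip Fin.≟ tip
  ... | yes _ = refl
  ... | no tip≢tip = ⊥-elim (tip≢tip refl)

  σ-endpoint : ∀ {x} → x ≢ tip → ∀ {e} → x ∈ₑ e → σ x ∈ₑ f e
  σ-endpoint {x} x≢tip with x Fin.≟ tip
  ... | yes x≡tip = ⊥-elim (x≢tip x≡tip)
  ... | no x≢tip′ = proj₂ (star-image-centre x≢tip′)

  open StarCentres σ σ-tip σ-endpoint public using (section; f∘section; section-hom)

large-sections : ∀ d″ f → IsHomomorphism (LineDragon (4 + d″)) f → HomomorphicSection (LineDragon (4 + d″)) f
large-sections d″ f f-hom = section , f∘section , section-hom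
  where open LargeEndomorphism d″ f f-hom

module SmallDragon where
  open Dragon 3 (s≤s z≤n)
  open EndomorphismSearch _≟ₑ_ (λ e e' → isYes (adjacent? e e')) edges ∈-edges

  search-succeeds : T (search edges [] (λ e → e))
  search-succeeds = tt

  sections : ∀ f → IsHomomorphism (LineDragon 3) f → HomomorphicSection (LineDragon 3) f
  sections f f-hom = g , f∘g , g-hom
    where
    surjective-reflecting : (∀ e → ∃ λ e′ → f e′ ≡ e) × (∀ e e′ → T (isYes (adjacent? (f e) (f e′))) → T (isYes (adjacent? e e′)))
    surjective-reflecting = homomorphisms-surjective-reflecting search-succeeds f λ e e' a →
      fromWitness {a? = adjacent? (f e) (f e')} (f-hom {e} {e'} (toWitness a))
    g : Edge → Edge
    g e = proj₁ (proj₁ surjective-reflecting e)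
    f∘g : ∀ e → f (g e) ≡ e
    f∘g e = proj₂ (proj₁ surjective-reflecting e)
    g-hom : IsHomomorphism (LineDragon 3) g
    g-hom {e} {e'} a = toWitness (proj₂ surjective-reflecting (g e) (g e')
      (fromWitness {a? = adjacent? (f (g e)) (f (g e'))} (subst₂ (Adj L) (sym (f∘g e)) (sym (f∘g e')) a)))

lemma9 : (d : ℕ) → 3 ≤ d → IsCore (LineDragon d)
lemma9 _ (s≤s (s≤s (s≤s {n = zero} _))) = sections⇒isCore _ SmallDragon.sections
lemma9 _ (s≤s (s≤s (s≤s {n = suc d″} _))) = sections⇒isCore _ (large-sections d″)
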